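{- Let $G$ be a bridgeless cubic graph, let $M$ be a perfect matching of $G$, and let $A,B,C$ be three pairwise disjoint $M$-balanced matchings forming a good family. Then $\tau(G)\le 4$.
   Context: For a bridgeless cubic graph $G$, $\tau(G)$ is the minimum number of perfect matchings of $G$ whose union is $E(G)$. Given a perfect matching $M$ of $G$, a set $A\subseteq E(G)$ is an $M$-balanced matching if there is a perfect matching $M'$ of $G$ with $A=M\cap M'$. Note that $G\setminus M$ (deleting the edges of $M$) is a $2$-factor, i.e. a disjoint union of cycles. Three pairwise disjoint $M$-balanced matchings $A,B,C$ form a good family if: (i) every odd cycle of $G\setminus M$ has, for each of the three sets $A,B,C$, exactly one vertex incident with an edge of that set, and the three paths into which these three vertices divide the cycle all have odd length; (ii) for every even cycle of $G\setminus M$, at least two of the sets $A,B,C$ have no edge incident to a vertex of the cycle. -}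

module Defs where

open import Data.Nat using (ℕ; zero; suc; _+_; _*_; _∸_; _<_; _≤_)
open import Data.Nat.DivMod using (_mod_)
open import Data.Fin using (Fin; toℕ)
open import Data.Fin.Subset using (Subset; _∈_; _∉_)
open import Data.Product using (Σ; ∃; _×_; _,_; proj₁; proj₂)
open import Data.Sum using (_⊎_)
open import Data.Vec using (Vec; lookup)
open import Relation.Nullary using (¬_)
open import Relation.Binary.PropositionalEquality using (_≡_; _≢_)
open import Function using (Injective)

-- Finite multigraphs (parallel edges allowed, as usual for cubic graphs
-- in the perfect-matching-cover literature).  Vertices Fin n, edges Fin m,
-- each edge has two endpoints.

record Graph : Set where
  field
    n    : ℕ
    m    : ℕ
    ends : Fin m → Fin n × Fin n

open Graph public

Inc : (G : Graph) → Fin (m G) → Fin (n G) → Set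
Inc G e v = proj₁ (ends G e) ≡ v ⊎ proj₂ (ends G e) ≡ v

Joins : (G : Graph) → Fin (m G) → Fin (n G) → Fin (n G) → Set
Joins G e u v = ends G e ≡ (u , v) ⊎ ends G e ≡ (v , u)

Loopless : Graph → Set
Loopless G = ∀ e → proj₁ (ends G e) ≢ proj₂ (ends G e)

Cubic : Graph → Set
Cubic G = Loopless G ×
  (∀ v → Σ (Fin (m G)) λ e₁ → Σ (Fin (m G)) λ e₂ → Σ (Fin (m G)) λ e₃ →
     e₁ ≢ e₂ × e₁ ≢ e₃ × e₂ ≢ e₃ ×
     Inc G e₁ v × Inc G e₂ v × Inc G e₃ v ×
     (∀ e → Inc G e v → e ≡ e₁ ⊎ e ≡ e₂ ⊎ e ≡ e₃))

data ConnectedWithout (G : Graph) (x : Fin (m G)) :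
       Fin (n G) → Fin (n G) → Set where
  here : ∀ {u} → ConnectedWithout G x u u
  step : ∀ {u v w} (e : Fin (m G)) → e ≢ x → Joins G e u v →
         ConnectedWithout G x v w → ConnectedWithout G x u w

Bridgeless : Graph → Set
Bridgeless G = ∀ e → ConnectedWithout G e (proj₁ (ends G e)) (proj₂ (ends G e))

EdgeSet : Graph → Set
EdgeSet G = Subset (m G)

Covers : (G : Graph) → EdgeSet G → Fin (n G) → Set
Covers G X v = Σ (Fin (m G)) λ e → e ∈ X × Inc G e v

PerfectMatching : (G : Graph) → EdgeSet G → Set
PerfectMatching G M = ∀ v → Σ (Fin (m G)) λ e → e ∈ M × Inc G e v ×
  (∀ e' → e' ∈ M → Inc G e' v → e' ≡ e)

Balanced : (G : Graph) → EdgeSet G → EdgeSet G → Set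
Balanced G M A = Σ (EdgeSet G) λ M' → PerfectMatching G M' ×
  (∀ e → (e ∈ A → e ∈ M × e ∈ M') × (e ∈ M × e ∈ M' → e ∈ A))

Disjoint : (G : Graph) → EdgeSet G → EdgeSet G → Set
Disjoint G X Y = ∀ e → e ∈ X → e ∉ Y

-- Since G \ M is 2-regular, these are
-- exactly the cycles (components) of the 2-factor G \ M.

next : ∀ {k} → Fin (suc k) → Fin (suc k)
next {k} i = suc (toℕ i) mod (suc k)

record CycleOutside (G : Graph) (M : EdgeSet G) : Set where
  field
    len'    : ℕ
    vert    : Fin (suc (suc len')) → Fin (n G)
    edge    : Fin (suc (suc len')) → Fin (m G)
    vertInj : Injective _≡_ _≡_ vert
    edgeInj : Injective _≡_ _≡_ edge
    joins   : ∀ i → Joins G (edge i) (vert i) (vert (next i))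
    outside : ∀ i → edge i ∉ M

  len : ℕ
  len = suc (suc len')

open CycleOutside public

Odd : ℕ → Set
Odd k = ∃ λ t → k ≡ suc (2 * t)

Even : ℕ → Set
Even k = ∃ λ t → k ≡ 2 * t

UniqueCoverAt : (G : Graph) (M : EdgeSet G) (C : CycleOutside G M) →
                EdgeSet G → Fin (len C) → Set
UniqueCoverAt G M C X i = Covers G X (vert C i) ×
  (∀ j → Covers G X (vert C j) → j ≡ i)

Touches : (G : Graph) (M : EdgeSet G) (C : CycleOutside G M) → EdgeSet G → Set
Touches G M C X = Σ (Fin (len C)) λ i → Covers G X (vert C i)

-- positions a < b < c on a cycle of length k cut it into three paths of
-- lengths b - a, c - b and k - c + a
ThreeOddArcsSorted : ℕ → ℕ → ℕ → ℕ → Set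
ThreeOddArcsSorted k a b c =
  a < b × b < c × Odd (b ∸ a) × Odd (c ∸ b) × Odd ((k + a) ∸ c)

ThreeOddArcs : ℕ → ℕ → ℕ → ℕ → Set
ThreeOddArcs k p q r =
  ThreeOddArcsSorted k p q r ⊎ ThreeOddArcsSorted k p r q ⊎
  ThreeOddArcsSorted k q p r ⊎ ThreeOddArcsSorted k q r p ⊎
  ThreeOddArcsSorted k r p q ⊎ ThreeOddArcsSorted k r q p

GoodFamily : (G : Graph) (M A B C : EdgeSet G) → Set
GoodFamily G M A B C =
  (∀ (Z : CycleOutside G M) → Odd (len Z) →
     Σ (Fin (len Z)) λ i → Σ (Fin (len Z)) λ j → Σ (Fin (len Z)) λ l →
       UniqueCoverAt G M Z A i × UniqueCoverAt G M Z B j ×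
       UniqueCoverAt G M Z C l × ThreeOddArcs (len Z) (toℕ i) (toℕ j) (toℕ l))
  ×
  (∀ (Z : CycleOutside G M) → Even (len Z) →
     (¬ Touches G M Z A × ¬ Touches G M Z B) ⊎
     (¬ Touches G M Z A × ¬ Touches G M Z C) ⊎
     (¬ Touches G M Z B × ¬ Touches G M Z C))

-- τ(G) ≤ k : E(G) is the union of (at most) k perfect matchings
-- (repetitions allowed, so "at most k" = "exactly k" in the list)
TauAtMost : Graph → ℕ → Set
TauAtMost G k = Σ (Vec (EdgeSet G) k) λ Ms →
  (∀ t → PerfectMatching G (lookup Ms t)) ×
  (∀ e → Σ (Fin k) λ t → e ∈ lookup Ms t)

module Submission where

-- Write A = M ∩ MA, B = M ∩ MB, C = M ∩ MC for perfect matchings MA, MB,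
-- MC.  At a vertex covered by A, MA uses the M-edge; at any other vertex it
-- uses exactly one of the two edges of the 2-factor G ∖ M there.  So along a
-- cycle of G ∖ M the matching MA alternates, except that it avoids both
-- edges at a vertex covered by A.  The four perfect matchings are M, MA and
-- NB, NC, obtained from MB and MC by switching them along some even cycles
-- of G ∖ M that B (resp. C) avoids.  An edge e of an odd cycle lies in MA,
-- MB or MC, since one of the three cover points sits at a nonzero even
-- distance after e; odd cycles are never switched.  On an even cycle two of
-- A, B, C are absent, so the two matchings alternate there: either they are
-- already complementary, or they agree and switching one makes them so.

open import Defs
open import Data.Nat using (ℕ; zero; suc; _+_; _*_; _∸_; _<_; _%_; _/_; NonZero; s≤s)
import Data.Nat.Properties as ℕP
import Data.Nat.DivMod as DM
open DM using (_mod_)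
open import Data.Nat.Tactic.RingSolver using (solve-∀)
open import Data.Fin using (Fin; zero; suc; toℕ; combine)
import Data.Fin.Properties as FinP
open import Data.Fin.Subset using (Subset; _∈_; _∉_)
open import Data.Fin.Subset.Properties using (_∈?_)
open import Data.Bool using (Bool; true; false; not; _xor_)
import Data.Bool.Properties as Bool
open import Data.Bool.Properties using (not-involutive; xor-identityʳ; ¬-not)
open import Data.Vec using (Vec; lookup; tabulate; _∷_; [])
open import Data.Vec.Properties using ([]=⇒lookup; lookup⇒[]=; lookup∘tabulate)
open import Data.Product using (Σ; ∃; _×_; _,_; proj₁; proj₂; swap)
open import Data.Product.Properties using (≡-dec)
import Data.Sum
open import Data.Sum using (_⊎_; inj₁; inj₂; [_,_]; [_,_]′)
open import Data.Empty using (⊥-elim-irr)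
open import Function using (_∘_; id)
open import Relation.Nullary using (¬_; Dec; yes; no; does; contradiction)
open import Relation.Nullary.Decidable using (_×-dec_; _⊎-dec_; ¬?; dec-true)
open import Relation.Binary.Definitions using (tri<; tri≈; tri>)
open import Relation.Binary.PropositionalEquality
  using (_≡_; _≢_; refl; sym; trans; cong; cong₂; subst; module ≡-Reasoning)

2+2t≡2[1+t] : ∀ t → suc (suc (2 * t)) ≡ 2 * suc t
2+2t≡2[1+t] = solve-∀

even-or-odd : ∀ k → Even k ⊎ Odd k
even-or-odd zero = inj₁ (0 , refl)
even-or-odd (suc k) with even-or-odd k
... | inj₁ (t , k≡2t)   = inj₂ (t , cong suc k≡2t)
... | inj₂ (t , k≡1+2t) = inj₁ (suc t , trans (cong suc k≡1+2t) (2+2t≡2[1+t] t))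

EvenPositive : ℕ → Set
EvenPositive x = ∃ λ q → x ≡ 2 * suc q

zero-or-evenPositive-or-odd : ∀ a → a ≡ 0 ⊎ EvenPositive a ⊎ Odd a
zero-or-evenPositive-or-odd a with even-or-odd a
... | inj₁ (zero , a≡0)  = inj₁ a≡0
... | inj₁ (suc q , a≡2q) = inj₂ (inj₁ (q , a≡2q))
... | inj₂ a-odd         = inj₂ (inj₂ a-odd)

isOdd : ℕ → Bool
isOdd zero    = false
isOdd (suc d) = not (isOdd d)

isOdd-1+2q : ∀ q → isOdd (suc (2 * q)) ≡ true
isOdd-1+2q zero    = refl
isOdd-1+2q (suc q) = begin
  isOdd (suc (2 * suc q))               ≡⟨ cong (isOdd ∘ suc) (sym (2+2t≡2[1+t] q)) ⟩
  not (not (isOdd (suc (2 * q))))       ≡⟨ cong (not ∘ not) (isOdd-1+2q q) ⟩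
  true                                  ∎
  where open ≡-Reasoning

-- Three cut points at odd distances around a cycle: measured from any
-- base point 0, one of them sits at a nonzero even position.  (If the
-- first cut point is 0 the last one is at odd + odd; if it is odd, the
-- second one is at odd + odd.)

odd-gap : ∀ {a b} → a < b → Odd (b ∸ a) → ∃ λ t → b ≡ suc (2 * t) + a
odd-gap {a} a<b (t , b∸a≡1+2t) =
  t , trans (sym (ℕP.m∸n+n≡m (ℕP.<⇒≤ a<b))) (cong (_+ a) b∸a≡1+2t)

odd+odd : ∀ s t → suc (2 * s) + suc (2 * t) ≡ 2 * suc (s + t)
odd+odd = solve-∀

sortedOddArcs⇒evenPositive : ∀ {k a b c} → ThreeOddArcsSorted k a b c →
  EvenPositive a ⊎ EvenPositive b ⊎ EvenPositive c
sortedOddArcs⇒evenPositive {a = a} (a<b , b<c , odd-ba , odd-cb , _)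
  with odd-gap a<b odd-ba | odd-gap b<c odd-cb | zero-or-evenPositive-or-odd a
... | t , b≡ | u , c≡ | inj₁ refl = inj₂ (inj₂ (u + t , (begin
  _                           ≡⟨ c≡ ⟩
  suc (2 * u) + _             ≡⟨ cong (suc (2 * u) +_) (trans b≡ (ℕP.+-identityʳ _)) ⟩
  suc (2 * u) + suc (2 * t)   ≡⟨ odd+odd u t ⟩
  2 * suc (u + t)             ∎)))
  where open ≡-Reasoning
... | _ | _ | inj₂ (inj₁ a-even) = inj₁ a-even
... | t , b≡ | _ | inj₂ (inj₂ (s , a≡)) =
  inj₂ (inj₁ (t + s , trans b≡ (trans (cong (suc (2 * t) +_) a≡) (odd+odd t s))))

oddArcs⇒evenPositive : ∀ {k p q r} → ThreeOddArcs k p q r →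
  EvenPositive p ⊎ EvenPositive q ⊎ EvenPositive r
oddArcs⇒evenPositive (inj₁ pqr) = sortedOddArcs⇒evenPositive pqr
oddArcs⇒evenPositive (inj₂ (inj₁ prq)) =
  [ inj₁ , [ inj₂ ∘ inj₂ , inj₂ ∘ inj₁ ] ] (sortedOddArcs⇒evenPositive prq)
oddArcs⇒evenPositive (inj₂ (inj₂ (inj₁ qpr))) =
  [ inj₂ ∘ inj₁ , [ inj₁ , inj₂ ∘ inj₂ ] ] (sortedOddArcs⇒evenPositive qpr)
oddArcs⇒evenPositive (inj₂ (inj₂ (inj₂ (inj₁ qrp)))) =
  [ inj₂ ∘ inj₁ , [ inj₂ ∘ inj₂ , inj₁ ] ] (sortedOddArcs⇒evenPositive qrp)
oddArcs⇒evenPositive (inj₂ (inj₂ (inj₂ (inj₂ (inj₁ rpq))))) =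
  [ inj₂ ∘ inj₂ , [ inj₁ , inj₂ ∘ inj₁ ] ] (sortedOddArcs⇒evenPositive rpq)
oddArcs⇒evenPositive (inj₂ (inj₂ (inj₂ (inj₂ (inj₂ rqp))))) =
  [ inj₂ ∘ inj₂ , [ inj₂ ∘ inj₁ , inj₁ ] ] (sortedOddArcs⇒evenPositive rqp)

toℕ-next : ∀ {k} (i : Fin (suc k)) → toℕ (next i) ≡ suc (toℕ i) % suc k
toℕ-next i = FinP.toℕ-fromℕ< _

next-≢ : ∀ {k} (i : Fin (suc (suc k))) → next i ≢ i
next-≢ {k} i next≡i with ℕP.m≤n⇒m<n∨m≡n (FinP.toℕ<n i)
... | inj₁ 1+i<L = ℕP.1+n≢n (begin
  suc (toℕ i)                 ≡⟨ sym (DM.m<n⇒m%n≡m 1+i<L) ⟩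
  suc (toℕ i) % suc (suc k)   ≡⟨ sym (toℕ-next i) ⟩
  toℕ (next i)                ≡⟨ cong toℕ next≡i ⟩
  toℕ i                       ∎)
  where open ≡-Reasoning
... | inj₂ 1+i≡L = ℕP.0≢1+n (begin
  0                           ≡⟨ sym (DM.n%n≡0 (suc (suc k))) ⟩
  suc (suc k) % suc (suc k)   ≡⟨ DM.%-congˡ {o = suc (suc k)} (sym 1+i≡L) ⟩
  suc (toℕ i) % suc (suc k)   ≡⟨ sym (toℕ-next i) ⟩
  toℕ (next i)                ≡⟨ cong toℕ next≡i ⟩
  toℕ i                       ≡⟨ ℕP.suc-injective 1+i≡L ⟩
  suc k                       ∎)
  where open ≡-Reasoning

∉⇒false : ∀ {k} {S : Subset k} {e} → e ∉ S → lookup S e ≡ false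
∉⇒false {S = S} {e} e∉S with lookup S e in eq
... | true  = contradiction (lookup⇒[]= e S eq) e∉S
... | false = refl

≡true-iff : ∀ {a b} → (a ≡ true → b ≡ true) → (b ≡ true → a ≡ true) → a ≡ b
≡true-iff {true}  {true}  _ _ = refl
≡true-iff {true}  {false} a⇒b _ = sym (a⇒b refl)
≡true-iff {false} {true}  _ b⇒a = b⇒a refl
≡true-iff {false} {false} _ _ = refl

cover-or-switched : ∀ a b s → (s ≡ true → a ≡ b) → (a ≡ b → s ≡ true) → a ≡ true ⊎ b xor s ≡ true
cover-or-switched true  _     _     _     _    = inj₁ refl
cover-or-switched false false _     _     same = inj₂ (same refl)
cover-or-switched false true  true  agree _    = contradiction (agree refl) λ ()
cover-or-switched false true  false _     _    = inj₂ refl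

leastWitness : {Q : ℕ → Set} → (∀ d → Dec (Q d)) → ∀ {b} → Q b →
  Σ ℕ λ p → Q p × (∀ d → d < p → ¬ Q d)
leastWitness {Q} Q? {b} qb with search (suc b)
  where
  search : ∀ c → (∀ d → d < c → ¬ Q d) ⊎ Σ ℕ λ p → Q p × (∀ d → d < p → ¬ Q d)
  search zero = inj₁ λ _ ()
  search (suc c) with search c
  ... | inj₂ least = inj₂ least
  ... | inj₁ none with Q? c
  ...   | yes qc = inj₂ (c , qc , none)
  ...   | no ¬qc = inj₁ λ d d<1+c →
            [ none d , (λ { refl → ¬qc }) ] (ℕP.m<1+n⇒m<n∨m≡n d<1+c)
... | inj₁ none  = contradiction qb (none b (ℕP.n<1+n b))
... | inj₂ least = least

injective-below : {X : Set} {k : ℕ} (f : ℕ → X) →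
  (∀ {a b} → a < b → b < k → f a ≢ f b) →
  ∀ {i j : Fin k} → f (toℕ i) ≡ f (toℕ j) → i ≡ j
injective-below f distinct {i} {j} fi≡fj with ℕP.<-cmp (toℕ i) (toℕ j)
... | tri< i<j _ _ = contradiction fi≡fj (distinct i<j (FinP.toℕ<n j))
... | tri≈ _ i≡j _ = FinP.toℕ-injective i≡j
... | tri> _ _ j<i = contradiction (sym fi≡fj) (distinct j<i (FinP.toℕ<n i))

regroup : ∀ r k q → r + (k + q * k) ≡ (r + q * k) + k
regroup = solve-∀

periodic-% : {X : Set} (f : ℕ → X) (k : ℕ) .{{_ : NonZero k}} →
  (∀ t → f (t + k) ≡ f t) → ∀ t → f (t % k) ≡ f t
periodic-% f k period t =
  trans (sym (shift (t / k))) (cong f (sym (DM.m≡m%n+[m/n]*n t k)))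
  where
  shift : ∀ q → f (t % k + q * k) ≡ f (t % k)
  shift zero    = cong f (ℕP.+-identityʳ _)
  shift (suc q) = trans (cong f (regroup (t % k) k q)) (trans (period _) (shift q))

removeOne : {A : Set} (P : A → Set) {a b c μ : A} →
  a ≢ b → a ≢ c → b ≢ c → P a → P b → P c → μ ≡ a ⊎ μ ≡ b ⊎ μ ≡ c →
  Σ A λ f → Σ A λ g → f ≢ g × f ≢ μ × g ≢ μ × P f × P g ×
    (∀ x → x ≡ a ⊎ x ≡ b ⊎ x ≡ c → x ≡ μ ⊎ x ≡ f ⊎ x ≡ g)
removeOne P a≢b a≢c b≢c pa pb pc (inj₁ refl) =
  _ , _ , b≢c , a≢b ∘ sym , a≢c ∘ sym , pb , pc , λ _ → id
removeOne P a≢b a≢c b≢c pa pb pc (inj₂ (inj₁ refl)) =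
  _ , _ , a≢c , a≢b , b≢c ∘ sym , pa , pc , λ _ → [ inj₂ ∘ inj₁ , [ inj₁ , inj₂ ∘ inj₂ ] ]
removeOne P a≢b a≢c b≢c pa pb pc (inj₂ (inj₂ refl)) =
  _ , _ , a≢b , a≢c , b≢c , pa , pb , λ _ → [ inj₂ ∘ inj₁ , [ inj₂ ∘ inj₂ , inj₁ ] ]

module Endpoints (G : Graph) (loopless : Loopless G) where

  joins⇒inc : ∀ {e u w} → Joins G e u w → Inc G e u × Inc G e w
  joins⇒inc (inj₁ q) = inj₁ (cong proj₁ q) , inj₂ (cong proj₂ q)
  joins⇒inc (inj₂ q) = inj₂ (cong proj₂ q) , inj₁ (cong proj₁ q)

  joins-ends : ∀ {e u w x} → Joins G e u w → Inc G e x → x ≡ u ⊎ x ≡ w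
  joins-ends (inj₁ q) (inj₁ p) = inj₁ (trans (sym p) (cong proj₁ q))
  joins-ends (inj₁ q) (inj₂ p) = inj₂ (trans (sym p) (cong proj₂ q))
  joins-ends (inj₂ q) (inj₁ p) = inj₂ (trans (sym p) (cong proj₁ q))
  joins-ends (inj₂ q) (inj₂ p) = inj₁ (trans (sym p) (cong proj₂ q))

  across : Fin (m G) → Fin (n G) → Fin (n G)
  across e v with proj₁ (ends G e) FinP.≟ v
  ... | yes _ = proj₂ (ends G e)
  ... | no _  = proj₁ (ends G e)

  across-≢ : ∀ e v → across e v ≢ v
  across-≢ e v with proj₁ (ends G e) FinP.≟ v
  ... | yes end₁≡v = λ end₂≡v → loopless e (trans end₁≡v (sym end₂≡v))
  ... | no end₁≢v  = end₁≢v

  joins-across : ∀ {e v} → Inc G e v → Joins G e v (across e v)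
  joins-across {e} {v} inc with proj₁ (ends G e) FinP.≟ v | inc
  ... | yes end₁≡v | _       = inj₁ (cong (_, proj₂ (ends G e)) end₁≡v)
  ... | no end₁≢v | inj₁ end₁≡v = contradiction end₁≡v end₁≢v
  ... | no _      | inj₂ end₂≡v = inj₂ (cong (proj₁ (ends G e) ,_) end₂≡v)

  across-unique : ∀ {e v w} → Inc G e v → Inc G e w → w ≢ v → w ≡ across e v
  across-unique inc-v inc-w w≢v =
    [ (λ w≡v → contradiction w≡v w≢v) , id ] (joins-ends (joins-across inc-v) inc-w)

  across-inc : ∀ {e v} → Inc G e v → Inc G e (across e v)
  across-inc inc = proj₂ (joins⇒inc (joins-across inc))

  across-across : ∀ {e v} → Inc G e v → across e (across e v) ≡ v
  across-across {e} {v} inc =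
    sym (across-unique (across-inc inc) inc (λ v≡ → across-≢ e v (sym v≡)))

module TwoFactor (G : Graph) (cubic : Cubic G) (M : EdgeSet G)
                 (M-perfect : PerfectMatching G M) where

  open Endpoints G (proj₁ cubic) public

  V : Set
  V = Fin (n G)

  E : Set
  E = Fin (m G)

  OutEdge : E → V → Set
  OutEdge e v = Inc G e v × e ∉ M

  record OutPair (v : V) : Set where
    field
      out₁ out₂ : E
      out₁≢out₂ : out₁ ≢ out₂
      isOut₁    : OutEdge out₁ v
      isOut₂    : OutEdge out₂ v
      only      : ∀ e → OutEdge e v → e ≡ out₁ ⊎ e ≡ out₂

  outPair : ∀ v → OutPair v
  outPair v with proj₂ cubic v | M-perfect v
  ... | e₁ , e₂ , e₃ , e₁≢e₂ , e₁≢e₃ , e₂≢e₃ , inc₁ , inc₂ , inc₃ , star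
      | μ , μ∈M , μ-inc , μ-unique
      with removeOne (λ e → Inc G e v) e₁≢e₂ e₁≢e₃ e₂≢e₃ inc₁ inc₂ inc₃ (star μ μ-inc)
  ... | f , g , f≢g , f≢μ , g≢μ , f-inc , g-inc , rest = record
    { out₁ = f ; out₂ = g ; out₁≢out₂ = f≢g
    ; isOut₁ = f-inc , ∉M f-inc f≢μ ; isOut₂ = g-inc , ∉M g-inc g≢μ
    ; only = λ e e-out → [ (λ e≡μ → contradiction (subst (_∈ M) (sym e≡μ) μ∈M) (proj₂ e-out))
                         , id ] (rest e (star e (proj₁ e-out))) }
    where
    ∉M : ∀ {e} → Inc G e v → e ≢ μ → e ∉ M
    ∉M inc e≢μ e∈M = e≢μ (μ-unique _ e∈M inc)

  out-exhaust : ∀ {v g h e} → g ≢ h → OutEdge g v → OutEdge h v → OutEdge e v →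
    e ≡ g ⊎ e ≡ h
  out-exhaust {v} {g} {h} {e} g≢h g-out h-out e-out
    with only g g-out | only h h-out | only e e-out
    where open OutPair (outPair v)
  ... | inj₁ g≡₁ | inj₁ h≡₁ | _ = contradiction (trans g≡₁ (sym h≡₁)) g≢h
  ... | inj₂ g≡₂ | inj₂ h≡₂ | _ = contradiction (trans g≡₂ (sym h≡₂)) g≢h
  ... | inj₁ g≡₁ | inj₂ _   | inj₁ e≡₁ = inj₁ (trans e≡₁ (sym g≡₁))
  ... | inj₁ _   | inj₂ h≡₂ | inj₂ e≡₂ = inj₂ (trans e≡₂ (sym h≡₂))
  ... | inj₂ _   | inj₁ h≡₁ | inj₁ e≡₁ = inj₂ (trans e≡₁ (sym h≡₁))
  ... | inj₂ g≡₂ | inj₁ _   | inj₂ e≡₂ = inj₁ (trans e≡₂ (sym g≡₂))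

  turn : V → E → E
  turn v e with OutPair.out₁ (outPair v) FinP.≟ e
  ... | yes _ = OutPair.out₂ (outPair v)
  ... | no _  = OutPair.out₁ (outPair v)

  turn-out : ∀ v e → OutEdge (turn v e) v
  turn-out v e with OutPair.out₁ (outPair v) FinP.≟ e
  ... | yes _ = OutPair.isOut₂ (outPair v)
  ... | no _  = OutPair.isOut₁ (outPair v)

  turn-≢ : ∀ v e → turn v e ≢ e
  turn-≢ v e with OutPair.out₁ (outPair v) FinP.≟ e
  ... | yes out₁≡e = λ out₂≡e → OutPair.out₁≢out₂ (outPair v) (trans out₁≡e (sym out₂≡e))
  ... | no out₁≢e  = out₁≢e

  turn-unique : ∀ {v e g} → OutEdge e v → OutEdge g v → g ≢ e → g ≡ turn v e
  turn-unique {v} {e} e-out g-out g≢e =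
    [ (λ g≡e → contradiction g≡e g≢e) , id ]
      (out-exhaust (turn-≢ v e ∘ sym) e-out (turn-out v e) g-out)

  turn-turn : ∀ {v e} → OutEdge e v → turn v (turn v e) ≡ e
  turn-turn {v} {e} e-out = sym (turn-unique (turn-out v e) e-out (turn-≢ v e ∘ sym))

  -- Darts: a dart (v , e) stands at v on an edge e of G ∖ M.  Advancing
  -- traverses e and turns onto the other edge of G ∖ M at the far end.

  Dart : Set
  Dart = V × E

  IsDart : Dart → Set
  IsDart (v , e) = OutEdge e v

  advance : Dart → Dart
  advance (v , e) = across e v , turn (across e v) e

  reverse : Dart → Dart
  reverse (v , e) = across e v , e

  advance-dart : ∀ d → IsDart (advance d)
  advance-dart (v , e) = turn-out (across e v) e

  reverse-dart : ∀ d → IsDart d → IsDart (reverse d)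
  reverse-dart (v , e) (inc , e∉M) = across-inc inc , e∉M

  reverse-involutive : ∀ d → IsDart d → reverse (reverse d) ≡ d
  reverse-involutive (v , e) (inc , _) = cong (_, e) (across-across inc)

  reverse-≢ : ∀ d → reverse d ≢ d
  reverse-≢ (v , e) eq = across-≢ e v (cong proj₁ eq)

  reverse-≢-advance : ∀ d → IsDart d → reverse d ≢ advance d
  reverse-≢-advance (v , e) d-dart eq =
    turn-≢ (across e v) e (sym (cong proj₂ eq))

  reverse-via-advance : ∀ d → IsDart d →
    reverse d ≡ (proj₁ (advance d) , turn (proj₁ (advance d)) (proj₂ (advance d)))
  reverse-via-advance (v , e) d-dart =
    cong (across e v ,_) (sym (turn-turn (reverse-dart (v , e) d-dart)))

  advance-reverse-advance : ∀ d → IsDart d → advance (reverse (advance d)) ≡ reverse d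
  advance-reverse-advance (v , e) (inc , e∉M) =
    cong₂ _,_ back-at-w (trans (cong (λ x → turn x e') back-at-w) (turn-turn e-out-w))
    where
    w = across e v
    e' = turn w e
    back-at-w : across e' (across e' w) ≡ w
    back-at-w = across-across (proj₁ (turn-out w e))
    e-out-w : OutEdge e w
    e-out-w = across-inc inc , e∉M

  advance-injective : ∀ {d d'} → IsDart d → IsDart d' → advance d ≡ advance d' → d ≡ d'
  advance-injective {v , e} {v' , e'} (inc , e∉M) (inc' , e'∉M) eq = cong₂ _,_ v≡v' e≡e'
    where
    w≡w' : across e v ≡ across e' v'
    w≡w' = cong proj₁ eq
    e≡e' : e ≡ e'
    e≡e' = begin
      e                                   ≡⟨ sym (turn-turn (across-inc inc , e∉M)) ⟩
      turn (across e v) (turn (across e v) e) ≡⟨ cong₂ turn w≡w' (cong proj₂ eq) ⟩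
      turn (across e' v') (turn (across e' v') e') ≡⟨ turn-turn (across-inc inc' , e'∉M) ⟩
      e'                                  ∎
      where open ≡-Reasoning
    v≡v' : v ≡ v'
    v≡v' = begin
      v                       ≡⟨ sym (across-across inc) ⟩
      across e (across e v)   ≡⟨ cong₂ across e≡e' w≡w' ⟩
      across e' (across e' v') ≡⟨ across-across inc' ⟩
      v'                      ∎
      where open ≡-Reasoning

  -- Following darts from a starting dart traces the cycle of G ∖ M through it.
  module Orbit (d₀ : Dart) (d₀-dart : IsDart d₀) where

    walk : ℕ → Dart
    walk zero    = d₀
    walk (suc t) = advance (walk t)

    walk-dart : ∀ t → IsDart (walk t)
    walk-dart zero    = d₀-dart
    walk-dart (suc t) = advance-dart (walk t)

    walk-cancel : ∀ i {a b} → walk (i + a) ≡ walk (i + b) → walk a ≡ walk b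
    walk-cancel zero    eq = eq
    walk-cancel (suc i) {a} {b} eq =
      walk-cancel i (advance-injective (walk-dart (i + a)) (walk-dart (i + b)) eq)

    never-reverses-ahead : ∀ d a → reverse (walk a) ≢ walk (d + a)
    never-reverses-ahead zero          a = reverse-≢ (walk a)
    never-reverses-ahead (suc zero)    a = reverse-≢-advance (walk a) (walk-dart a)
    never-reverses-ahead (suc (suc d)) a eq =
      never-reverses-ahead d (suc a) (trans one-back (cong walk (sym (ℕP.+-suc d a))))
      where
      one-back : reverse (walk (suc a)) ≡ walk (suc d + a)
      one-back = advance-injective (reverse-dart _ (walk-dart (suc a))) (walk-dart (suc d + a))
                   (trans (advance-reverse-advance (walk a) (walk-dart a)) eq)

    never-reverses : ∀ a b → reverse (walk a) ≢ walk b
    never-reverses a b eq with ℕP.≤-total a b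
    ... | inj₁ a≤b = never-reverses-ahead (b ∸ a) a (trans eq (cong walk (sym (ℕP.m∸n+n≡m a≤b))))
    ... | inj₂ b≤a = never-reverses-ahead (a ∸ b) b (begin
      reverse (walk b)             ≡⟨ cong reverse (sym eq) ⟩
      reverse (reverse (walk a))   ≡⟨ reverse-involutive (walk a) (walk-dart a) ⟩
      walk a                       ≡⟨ cong walk (sym (ℕP.m∸n+n≡m b≤a)) ⟩
      walk (a ∸ b + b)             ∎)
      where open ≡-Reasoning

    -- by the pigeonhole principle on the finitely many darts, the walk returns
    returns : ∃ λ d → walk (suc d) ≡ walk 0
    returns with FinP.pigeonhole (ℕP.n<1+n (n G * m G)) (λ i → encode (walk (toℕ i)))
      where
      encode : Dart → Fin (n G * m G)
      encode (v , e) = combine v e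
    ... | i , j , i<j , same-code with ℕP.m≤n⇒∃[o]m+o≡n i<j
    ...   | o , i+1+o≡j = o , sym (walk-cancel (toℕ i) (begin
      walk (toℕ i + 0)       ≡⟨ cong walk (ℕP.+-identityʳ _) ⟩
      walk (toℕ i)           ≡⟨ cong₂ _,_ (proj₁ same) (proj₂ same) ⟩
      walk (toℕ j)           ≡⟨ cong walk (trans (sym i+1+o≡j) (sym (ℕP.+-suc _ o))) ⟩
      walk (toℕ i + suc o)   ∎))
      where
      open ≡-Reasoning
      same = FinP.combine-injective _ _ _ _ same-code

    -- the least return time, at least 2 since one step changes the vertex;
    -- kept abstract so that it is never unfolded by the type checker
    abstract
      first-return : Σ ℕ λ l → walk (suc (suc l)) ≡ walk 0 ×
                                (∀ d → d < suc l → walk (suc d) ≢ walk 0)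
      first-return
        with leastWitness {λ d → walk (suc d) ≡ walk 0}
               (λ d → ≡-dec FinP._≟_ FinP._≟_ (walk (suc d)) (walk 0))
               {proj₁ returns} (proj₂ returns)
      ... | zero  , back , _       = contradiction (cong proj₁ back) (across-≢ (proj₂ d₀) (proj₁ d₀))
      ... | suc l , back , minimal = l , back , minimal

    l : ℕ
    l = proj₁ first-return

    period : ℕ
    period = suc (suc l)

    periodic : ∀ t → walk (t + period) ≡ walk t
    periodic zero    = proj₁ (proj₂ first-return)
    periodic (suc t) = cong advance (periodic t)

    walk-distinct : ∀ {a b} → a < b → b < period → walk a ≢ walk b
    walk-distinct {a} {b} a<b b<period eq with ℕP.m≤n⇒∃[o]m+o≡n a<b
    ... | o , a+1+o≡b = proj₂ (proj₂ first-return) o o<p (sym (walk-cancel a (begin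
      walk (a + 0)       ≡⟨ cong walk (ℕP.+-identityʳ a) ⟩
      walk a             ≡⟨ eq ⟩
      walk b             ≡⟨ cong walk b≡a+1+o ⟩
      walk (a + suc o)   ∎)))
      where
      open ≡-Reasoning
      b≡a+1+o : b ≡ a + suc o
      b≡a+1+o = trans (sym a+1+o≡b) (sym (ℕP.+-suc a o))
      o<p : o < suc l
      o<p = ℕP.≤-pred (ℕP.≤-<-trans (ℕP.m≤n+m (suc o) a) (subst (_< period) b≡a+1+o b<period))

    vertexAt : ℕ → V
    vertexAt t = proj₁ (walk t)

    edgeAt : ℕ → E
    edgeAt t = proj₂ (walk t)

    entering-reversed : ∀ a → reverse (walk (a + suc l)) ≡ (vertexAt a , turn (vertexAt a) (edgeAt a))
    entering-reversed a = begin
      reverse (walk (a + suc l))       ≡⟨ reverse-via-advance _ (walk-dart (a + suc l)) ⟩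
      (proj₁ (walk (suc (a + suc l))) , turn _ (proj₂ (walk (suc (a + suc l)))))
                                       ≡⟨ cong (λ d → proj₁ d , turn (proj₁ d) (proj₂ d)) back-to-a ⟩
      (vertexAt a , turn (vertexAt a) (edgeAt a)) ∎
      where
      open ≡-Reasoning
      back-to-a : walk (suc (a + suc l)) ≡ walk a
      back-to-a = trans (cong walk (sym (ℕP.+-suc a (suc l)))) (periodic a)

    vertex-distinct : ∀ {a b} → a < b → b < period → vertexAt a ≢ vertexAt b
    vertex-distinct {a} {b} a<b b<period va≡vb with edgeAt b FinP.≟ edgeAt a
    ... | yes eb≡ea = walk-distinct a<b b<period (cong₂ _,_ va≡vb (sym eb≡ea))
    ... | no eb≢ea  = never-reverses (a + suc l) b (begin
      reverse (walk (a + suc l))                ≡⟨ entering-reversed a ⟩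
      (vertexAt a , turn (vertexAt a) (edgeAt a)) ≡⟨ cong₂ _,_ va≡vb (sym eb≡turn) ⟩
      walk b                                    ∎)
      where
      open ≡-Reasoning
      eb≡turn : edgeAt b ≡ turn (vertexAt a) (edgeAt a)
      eb≡turn = turn-unique (walk-dart a) (subst (OutEdge (edgeAt b)) (sym va≡vb) (walk-dart b)) eb≢ea

    edge-distinct : ∀ {a b} → a < b → b < period → edgeAt a ≢ edgeAt b
    edge-distinct {a} {b} a<b b<period ea≡eb = never-reverses a b (cong₂ _,_ (sym vb≡across) ea≡eb)
      where
      vb≡across : vertexAt b ≡ across (edgeAt a) (vertexAt a)
      vb≡across = across-unique (proj₁ (walk-dart a))
                    (subst (λ e → Inc G e (vertexAt b)) (sym ea≡eb) (proj₁ (walk-dart b)))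
                    (vertex-distinct a<b b<period ∘ sym)

    cycle : CycleOutside G M
    cycle = record
      { len'    = l
      ; vert    = vertexAt ∘ toℕ
      ; edge    = edgeAt ∘ toℕ
      ; vertInj = injective-below vertexAt vertex-distinct
      ; edgeInj = injective-below edgeAt edge-distinct
      ; joins   = λ i → subst (Joins G (edgeAt (toℕ i)) (vertexAt (toℕ i)))
                              (cong proj₁ (sym (walk-next i)))
                              (joins-across (proj₁ (walk-dart (toℕ i))))
      ; outside = λ i → proj₂ (walk-dart (toℕ i))
      }
      where
      walk-next : ∀ (i : Fin period) → walk (toℕ (next i)) ≡ walk (suc (toℕ i))
      walk-next i = trans (cong walk (toℕ-next i)) (periodic-% walk period periodic (suc (toℕ i)))

  -- The cycle of G ∖ M through an edge e ∉ M, starting with e at position 0.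
  -- The proof of e ∉ M is irrelevant, so the cycle depends on e alone.
  cycleOf : (e : E) → .(e ∉ M) → CycleOutside G M
  cycleOf e e∉M = Orbit.cycle (proj₁ (ends G e) , e) (inj₁ refl , λ e∈M → ⊥-elim-irr (e∉M e∈M))

  module Around (Z : CycleOutside G M) where

    vertexAt : ℕ → V
    vertexAt t = vert Z (t mod len Z)

    edgeAt : ℕ → E
    edgeAt t = edge Z (t mod len Z)

    toℕ-mod : ∀ t → toℕ (t mod len Z) ≡ t % len Z
    toℕ-mod t = FinP.toℕ-fromℕ< _

    mod-toℕ : ∀ (i : Fin (len Z)) → toℕ i mod len Z ≡ i
    mod-toℕ i = FinP.toℕ-injective (trans (toℕ-mod (toℕ i)) (DM.m<n⇒m%n≡m (FinP.toℕ<n i)))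

    next-mod : ∀ t → next (t mod len Z) ≡ suc t mod len Z
    next-mod t = FinP.toℕ-injective (begin
      toℕ (next (t mod len Z))    ≡⟨ toℕ-next (t mod len Z) ⟩
      suc (toℕ (t mod len Z)) % len Z ≡⟨ DM.%-congˡ {o = len Z} (cong suc (toℕ-mod t)) ⟩
      (1 + t % len Z) % len Z     ≡⟨ sym (DM.%-distribˡ-+ 1 t (len Z)) ⟩
      suc t % len Z               ≡⟨ sym (toℕ-mod (suc t)) ⟩
      toℕ (suc t mod len Z)       ∎)
      where open ≡-Reasoning

    joinsAt : ∀ t → Joins G (edgeAt t) (vertexAt t) (vertexAt (suc t))
    joinsAt t = subst (Joins G (edgeAt t) (vertexAt t) ∘ vert Z) (next-mod t) (joins Z (t mod len Z))

    incoming : ∀ t → OutEdge (edgeAt t) (vertexAt (suc t))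
    incoming t = proj₂ (joins⇒inc (joinsAt t)) , outside Z _

    outgoing : ∀ t → OutEdge (edgeAt (suc t)) (vertexAt (suc t))
    outgoing t = proj₁ (joins⇒inc (joinsAt (suc t))) , outside Z _

    incoming≢outgoing : ∀ t → edgeAt t ≢ edgeAt (suc t)
    incoming≢outgoing t same = next-≢ (t mod len Z) (trans (next-mod t) (sym (edgeInj Z same)))

    entered : ∀ i → vertexAt (suc (toℕ i + suc (len' Z))) ≡ vert Z i
    entered i = cong (vert Z) (trans (FinP.toℕ-injective (begin
      toℕ (suc (toℕ i + suc (len' Z)) mod len Z) ≡⟨ toℕ-mod (suc (toℕ i + suc (len' Z))) ⟩
      suc (toℕ i + suc (len' Z)) % len Z         ≡⟨ DM.%-congˡ {o = len Z} (sym (ℕP.+-suc (toℕ i) _)) ⟩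
      (toℕ i + len Z) % len Z                    ≡⟨ DM.[m+n]%n≡m%n (toℕ i) (len Z) ⟩
      toℕ i % len Z                              ≡⟨ sym (toℕ-mod (toℕ i)) ⟩
      toℕ (toℕ i mod len Z)                      ∎)) (mod-toℕ i))
      where open ≡-Reasoning

  EdgeOn : CycleOutside G M → E → Set
  EdgeOn Z e = Σ (Fin (len Z)) λ i → edge Z i ≡ e

  VertexOn : CycleOutside G M → V → Set
  VertexOn Z v = Σ (Fin (len Z)) λ i → vert Z i ≡ v

  module _ (Z : CycleOutside G M) where
    open Around Z

    endpoint-on : ∀ {f w} → EdgeOn Z f → Inc G f w → VertexOn Z w
    endpoint-on (i , refl) inc =
      [ (λ w≡ → toℕ i mod len Z , sym w≡) , (λ w≡ → suc (toℕ i) mod len Z , sym w≡) ]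
        (joins-ends (joinsAt (toℕ i)) (subst (λ j → Inc G (edge Z j) _) (sym (mod-toℕ i)) inc))

    outEdge-on : ∀ {v f} → VertexOn Z v → OutEdge f v → EdgeOn Z f
    outEdge-on (i , refl) f-out =
      [ (λ f≡ → t mod len Z , sym f≡) , (λ f≡ → suc t mod len Z , sym f≡) ]
        (out-exhaust (incoming≢outgoing t) (incoming t) (outgoing t)
          (subst (OutEdge _) (sym (entered i)) f-out))
      where
      t = toℕ i + suc (len' Z)

  record _⊆ᶜ_ (Z₁ Z₂ : CycleOutside G M) : Set where
    field
      edges-on    : ∀ i → EdgeOn Z₂ (edge Z₁ i)
      vertices-on : ∀ i → VertexOn Z₂ (vert Z₁ i)

  SameCycle : CycleOutside G M → CycleOutside G M → Set
  SameCycle Z₁ Z₂ = Z₁ ⊆ᶜ Z₂ × Z₂ ⊆ᶜ Z₁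

  first-edge⇒⊆ : ∀ Z₁ Z₂ → EdgeOn Z₂ (edge Z₁ zero) → Z₁ ⊆ᶜ Z₂
  first-edge⇒⊆ Z₁ Z₂ first-on = record { edges-on = edges-on ; vertices-on = vertices-on }
    where
    open Around Z₁
    along : ∀ t → EdgeOn Z₂ (edgeAt t)
    along zero    = first-on
    along (suc t) = outEdge-on Z₂ (endpoint-on Z₂ (along t) (proj₁ (incoming t))) (outgoing t)
    edges-on : ∀ i → EdgeOn Z₂ (edge Z₁ i)
    edges-on i = subst (EdgeOn Z₂ ∘ edge Z₁) (mod-toℕ i) (along (toℕ i))
    vertices-on : ∀ i → VertexOn Z₂ (vert Z₁ i)
    vertices-on i = endpoint-on Z₂ (edges-on i) (proj₁ (joins⇒inc (joins Z₁ i)))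

  on-cycleOf : ∀ {e v} (e-out : OutEdge e v) → VertexOn (cycleOf e (proj₂ e-out)) v
  on-cycleOf {e} (inc , e∉M) = endpoint-on (cycleOf e e∉M) (zero , refl) inc

  adjacent-same : ∀ {e g v} (e-out : OutEdge e v) (g-out : OutEdge g v) →
    SameCycle (cycleOf e (proj₂ e-out)) (cycleOf g (proj₂ g-out))
  adjacent-same {e} {g} e-out g-out =
    first-edge⇒⊆ Z Z' (outEdge-on Z' (on-cycleOf g-out) e-out) ,
    first-edge⇒⊆ Z' Z (outEdge-on Z (on-cycleOf e-out) g-out)
    where
    Z  = cycleOf e (proj₂ e-out)
    Z' = cycleOf g (proj₂ g-out)

  BalancedBy : EdgeSet G → EdgeSet G → Set
  BalancedBy X MX = ∀ e → (e ∈ X → e ∈ M × e ∈ MX) × (e ∈ M × e ∈ MX → e ∈ X)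

  Untouched : CycleOutside G M → EdgeSet G → Set
  Untouched Z X = ¬ Touches G M Z X

  module Balanced (X MX : EdgeSet G) (MX-perfect : PerfectMatching G MX)
                  (X-balanced : BalancedBy X MX) where

    -- at a vertex covered by X its MX-edge is its M-edge, so no edge of
    -- G ∖ M there lies in MX
    covered⇒out∉ : ∀ {w g} → Covers G X w → OutEdge g w → lookup MX g ≡ false
    covered⇒out∉ {w} {g} (x , x∈X , x-inc) (g-inc , g∉M) = ∉⇒false λ g∈MX →
      g∉M (subst (_∈ M) (trans (unique x x∈MX x-inc) (sym (unique g g∈MX g-inc))) x∈M)
      where
      unique = proj₂ (proj₂ (proj₂ (MX-perfect w)))
      x∈M  = proj₁ (proj₁ (X-balanced x) x∈X)
      x∈MX = proj₂ (proj₁ (X-balanced x) x∈X)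

    -- at a vertex not covered by X its MX-edge lies in G ∖ M, so exactly one
    -- of the two edges of G ∖ M there lies in MX
    uncovered⇒alternate : ∀ {w g h} → ¬ Covers G X w → g ≢ h → OutEdge g w → OutEdge h w →
      lookup MX g ≡ not (lookup MX h)
    uncovered⇒alternate {w} {g} {h} uncovered g≢h g-out h-out with MX-perfect w
    ... | μ , μ∈MX , μ-inc , unique with μ ∈? M
    ...   | yes μ∈M = contradiction (μ , proj₂ (X-balanced μ) (μ∈M , μ∈MX) , μ-inc) uncovered
    ...   | no μ∉M with out-exhaust g≢h g-out h-out (μ-inc , μ∉M)
    ...     | inj₁ refl = trans ([]=⇒lookup μ∈MX)
                            (cong not (sym (∉⇒false λ h∈MX → g≢h (sym (unique h h∈MX (proj₁ h-out))))))
    ...     | inj₂ refl = trans (∉⇒false λ g∈MX → g≢h (unique g g∈MX (proj₁ g-out)))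
                            (cong not (sym ([]=⇒lookup μ∈MX)))

    module AlongCycle (Z : CycleOutside G M) where
      open Around Z

      before-covered : ∀ t → Covers G X (vertexAt (suc t)) → lookup MX (edgeAt t) ≡ false
      before-covered t covered = covered⇒out∉ covered (incoming t)

      alternates : ∀ t → ¬ Covers G X (vertexAt (suc t)) →
        lookup MX (edgeAt t) ≡ not (lookup MX (edgeAt (suc t)))
      alternates t uncovered =
        uncovered⇒alternate uncovered (incoming≢outgoing t) (incoming t) (outgoing t)

      -- If X covers exactly one vertex of Z, at a nonzero even position x,
      -- then the first edge of Z lies in MX: walking back from x the edges
      -- alternate, the one just before x being outside MX.
      first-edge-in : ∀ {x} → UniqueCoverAt G M Z X x → EvenPositive (toℕ x) →
        edge Z zero ∈ MX
      first-edge-in {x} (x-covered , only-x) (q , x≡2+2q) =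
        lookup⇒[]= _ MX (trans (parity (suc (2 * q)) 0 (trans (2+2t≡2[1+t] q) (sym x≡2+2q)))
                               (isOdd-1+2q q))
        where
        parity : ∀ d u → u + suc d ≡ toℕ x → lookup MX (edgeAt u) ≡ isOdd d
        parity zero u u+1≡x = before-covered u (subst (Covers G X ∘ vert Z) (sym at-x) x-covered)
          where
          at-x : suc u mod len Z ≡ x
          at-x = trans (cong (_mod len Z) (trans (ℕP.+-comm 1 u) u+1≡x)) (mod-toℕ x)
        parity (suc d) u u+2+d≡x =
          trans (alternates u uncovered)
                (cong not (parity d (suc u) (trans (sym (ℕP.+-suc u (suc d))) u+2+d≡x)))
          where
          1+u<x : suc u < toℕ x
          1+u<x = subst (suc u <_) (trans (sym u+2+d≡2+u+d) u+2+d≡x) (s≤s (s≤s (ℕP.m≤m+n u d)))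
            where
            u+2+d≡2+u+d : u + suc (suc d) ≡ suc (suc (u + d))
            u+2+d≡2+u+d = trans (ℕP.+-suc u (suc d)) (cong suc (ℕP.+-suc u d))
          uncovered : ¬ Covers G X (vertexAt (suc u))
          uncovered covered = ℕP.<-irrefl (begin
            suc u                     ≡⟨ sym (DM.m<n⇒m%n≡m (ℕP.<-trans 1+u<x (FinP.toℕ<n x))) ⟩
            suc u % len Z             ≡⟨ sym (toℕ-mod (suc u)) ⟩
            toℕ (suc u mod len Z)     ≡⟨ cong toℕ (only-x _ covered) ⟩
            toℕ x                     ∎) 1+u<x
            where open ≡-Reasoning

  Agree : CycleOutside G M → EdgeSet G → EdgeSet G → Set
  Agree Z MX MY = ∀ i → lookup MX (edge Z i) ≡ lookup MY (edge Z i)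

  -- On a cycle avoided by both X and Y, the matchings MX and MY alternate,
  -- so if they agree on the first edge they agree on the whole cycle.
  agree-around : ∀ {X MX Y MY} → PerfectMatching G MX → BalancedBy X MX →
    PerfectMatching G MY → BalancedBy Y MY → ∀ Z → Untouched Z X → Untouched Z Y →
    lookup MX (edge Z zero) ≡ lookup MY (edge Z zero) → Agree Z MX MY
  agree-around {X} {MX} {Y} {MY} MX-perfect X-balanced MY-perfect Y-balanced Z
               untouched-X untouched-Y same₀ i =
    subst (λ j → lookup MX (edge Z j) ≡ lookup MY (edge Z j)) (mod-toℕ i) (along (toℕ i))
    where
    open Around Z
    module AX = Balanced.AlongCycle X MX MX-perfect X-balanced Z
    module AY = Balanced.AlongCycle Y MY MY-perfect Y-balanced Z
    along : ∀ t → lookup MX (edgeAt t) ≡ lookup MY (edgeAt t)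
    along zero    = same₀
    along (suc t) = begin
      lookup MX (edgeAt (suc t))             ≡⟨ sym (not-involutive _) ⟩
      not (not (lookup MX (edgeAt (suc t)))) ≡⟨ cong not (sym (AX.alternates t (untouched-X ∘ at))) ⟩
      not (lookup MX (edgeAt t))             ≡⟨ cong not (along t) ⟩
      not (lookup MY (edgeAt t))             ≡⟨ cong not (AY.alternates t (untouched-Y ∘ at)) ⟩
      not (not (lookup MY (edgeAt (suc t)))) ≡⟨ not-involutive _ ⟩
      lookup MY (edgeAt (suc t))             ∎
      where
      open ≡-Reasoning
      at : ∀ {S} → Covers G S (vertexAt (suc t)) → Touches G M Z S
      at = suc t mod len Z ,_

  switch : EdgeSet G → (E → Bool) → EdgeSet G
  switch N s = tabulate λ e → lookup N e xor s e

  switch-lookup : ∀ N s e → lookup (switch N s) e ≡ lookup N e xor s e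
  switch-lookup N s = lookup∘tabulate (λ e → lookup N e xor s e)

  -- Switching N along whole cycles of G ∖ M on which N alternates yields a
  -- perfect matching: s vanishes on M, is constant at each vertex on the
  -- edges of G ∖ M, and is only set where the N-edge at the vertex is not in M.
  switch-perfect : ∀ {N} (s : E → Bool) → PerfectMatching G N →
    (∀ {e} → e ∈ M → s e ≡ false) →
    (∀ {v e g} → OutEdge e v → OutEdge g v → s e ≡ s g) →
    (∀ {v e f} → OutEdge e v → s e ≡ true → f ∈ N → Inc G f v → f ∉ M) →
    PerfectMatching G (switch N s)
  switch-perfect {N} s N-perfect s-M s-adjacent s-alternating v with N-perfect v
  ... | μ , μ∈N , μ-inc , μ-unique = at-v (μ ∈? M)
    where
    MatchedAt : EdgeSet G → Set
    MatchedAt X = Σ E λ e → e ∈ X × Inc G e v × (∀ e' → e' ∈ X → Inc G e' v → e' ≡ e)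

    unswitched-∈ : ∀ {f} → s f ≡ false → f ∈ switch N s → f ∈ N
    unswitched-∈ {f} s-f f∈ = lookup⇒[]= f N (begin
      lookup N f               ≡⟨ sym (xor-identityʳ _) ⟩
      lookup N f xor false     ≡⟨ cong (lookup N f xor_) (sym s-f) ⟩
      lookup N f xor s f       ≡⟨ sym (switch-lookup N s f) ⟩
      lookup (switch N s) f    ≡⟨ []=⇒lookup f∈ ⟩
      true                     ∎)
      where open ≡-Reasoning

    unswitched : (∀ {f} → Inc G f v → s f ≡ false) → MatchedAt (switch N s)
    unswitched s-0 = μ , μ∈ , μ-inc , λ f f∈ f-inc → μ-unique f (unswitched-∈ (s-0 f-inc) f∈) f-inc
      where
      μ∈ : μ ∈ switch N s
      μ∈ = lookup⇒[]= μ _ (trans (switch-lookup N s μ)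
                          (cong₂ _xor_ ([]=⇒lookup μ∈N) (s-0 μ-inc)))

    s-0-at-v : (∀ {f} → OutEdge f v → s f ≡ false) → ∀ {f} → Inc G f v → s f ≡ false
    s-0-at-v s-out {f} f-inc with f ∈? M
    ... | yes f∈M = s-M f∈M
    ... | no f∉M  = s-out (f-inc , f∉M)

    at-v : Dec (μ ∈ M) → MatchedAt (switch N s)
    at-v (yes μ∈M) = unswitched (s-0-at-v λ f-out →
      ¬-not λ s-f → s-alternating f-out s-f μ∈N μ-inc μ∈M)
    at-v (no μ∉M) with s μ in s-μ
    ... | false = unswitched (s-0-at-v λ f-out → trans (s-adjacent f-out (μ-inc , μ∉M)) s-μ)
    ... | true  = f , f∈ , proj₁ f-out , only-f
      where
      μ-out : OutEdge μ v
      μ-out = μ-inc , μ∉M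
      f = turn v μ
      f-out = turn-out v μ
      s-out : ∀ {g} → OutEdge g v → s g ≡ true
      s-out g-out = trans (s-adjacent g-out μ-out) s-μ
      f∈ : f ∈ switch N s
      f∈ = lookup⇒[]= f _ (trans (switch-lookup N s f)
             (cong₂ _xor_ (∉⇒false λ f∈N → turn-≢ v μ (μ-unique f f∈N (proj₁ f-out))) (s-out f-out)))
      only-f : ∀ g → g ∈ switch N s → Inc G g v → g ≡ f
      only-f g g∈ g-inc with g ∈? M
      ... | yes g∈M = contradiction (subst (_∈ M) (μ-unique g (unswitched-∈ (s-M g∈M) g∈) g-inc) g∈M) μ∉M
      ... | no g∉M  = turn-unique μ-out (g-inc , g∉M) λ g≡μ → contradiction (begin
        false                     ≡⟨⟩
        true xor true             ≡⟨ sym (cong₂ _xor_ (trans (cong (lookup N) g≡μ) ([]=⇒lookup μ∈N))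
                                                      (s-out (g-inc , g∉M))) ⟩
        lookup N g xor s g        ≡⟨ sym (switch-lookup N s g) ⟩
        lookup (switch N s) g     ≡⟨ []=⇒lookup g∈ ⟩
        true                      ∎) λ ()
        where open ≡-Reasoning

  touches-⊆ : ∀ {Z₁ Z₂} X → Z₁ ⊆ᶜ Z₂ → Touches G M Z₁ X → Touches G M Z₂ X
  touches-⊆ X Z₁⊆Z₂ (i , covered) =
    proj₁ (vertices-on i) , subst (Covers G X) (sym (proj₂ (vertices-on i))) covered
    where open _⊆ᶜ_ Z₁⊆Z₂

  untouched-⊆ : ∀ {Z₁ Z₂} X → Z₁ ⊆ᶜ Z₂ → Untouched Z₂ X → Untouched Z₁ X
  untouched-⊆ X Z₁⊆Z₂ untouched = untouched ∘ touches-⊆ X Z₁⊆Z₂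

  agree-⊆ : ∀ {Z₁ Z₂} MX MY → Z₁ ⊆ᶜ Z₂ → Agree Z₂ MX MY → Agree Z₁ MX MY
  agree-⊆ MX MY Z₁⊆Z₂ agree i =
    subst (λ f → lookup MX f ≡ lookup MY f) (proj₂ (edges-on i)) (agree (proj₁ (edges-on i)))
    where open _⊆ᶜ_ Z₁⊆Z₂

  touches? : ∀ Z X → Dec (Touches G M Z X)
  touches? Z X = FinP.any? λ i → FinP.any? λ e → (e ∈? X) ×-dec incident? e (vert Z i)
    where
    incident? : ∀ e v → Dec (Inc G e v)
    incident? e v = (proj₁ (ends G e) FinP.≟ v) ⊎-dec (proj₂ (ends G e) FinP.≟ v)

  agree? : ∀ Z MX MY → Dec (Agree Z MX MY)
  agree? Z MX MY = FinP.all? λ i → lookup MX (edge Z i) Bool.≟ lookup MY (edge Z i)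

  module SwitchOn (P : CycleOutside G M → Set) (P? : ∀ Z → Dec (P Z))
                  (P-same : ∀ {Z₁ Z₂} → SameCycle Z₁ Z₂ → P Z₁ → P Z₂)
                  (Y MY : EdgeSet G) (MY-perfect : PerfectMatching G MY)
                  (Y-balanced : BalancedBy Y MY)
                  (P-untouched : ∀ Z → P Z → Untouched Z Y) where

    switchOn : E → Bool
    switchOn e with e ∈? M
    ... | yes _   = false
    ... | no e∉M  = does (P? (cycleOf e e∉M))

    switchOn-M : ∀ {e} → e ∈ M → switchOn e ≡ false
    switchOn-M {e} e∈M with e ∈? M
    ... | yes _   = refl
    ... | no e∉M  = contradiction e∈M e∉M

    switchOn⇒P : ∀ {e} (e∉M : e ∉ M) → switchOn e ≡ true → P (cycleOf e e∉M)
    switchOn⇒P {e} e∉M switched with e ∈? M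
    ... | yes e∈M = contradiction e∈M e∉M
    ... | no _ with P? (cycleOf e e∉M)
    ...   | yes p = p

    P⇒switchOn : ∀ {e} (e∉M : e ∉ M) → P (cycleOf e e∉M) → switchOn e ≡ true
    P⇒switchOn {e} e∉M p with e ∈? M
    ... | yes e∈M = contradiction e∈M e∉M
    ... | no _    = dec-true (P? (cycleOf e e∉M)) p

    switchOn-adjacent : ∀ {v e g} → OutEdge e v → OutEdge g v → switchOn e ≡ switchOn g
    switchOn-adjacent e-out g-out = ≡true-iff
      (P⇒switchOn (proj₂ g-out) ∘ P-same (adjacent-same e-out g-out) ∘ switchOn⇒P (proj₂ e-out))
      (P⇒switchOn (proj₂ e-out) ∘ P-same (swap (adjacent-same e-out g-out)) ∘ switchOn⇒P (proj₂ g-out))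

    switched : EdgeSet G
    switched = switch MY switchOn

    switched-perfect : PerfectMatching G switched
    switched-perfect = switch-perfect switchOn MY-perfect switchOn-M switchOn-adjacent alternating
      where
      alternating : ∀ {v e f} → OutEdge e v → switchOn e ≡ true → f ∈ MY → Inc G f v → f ∉ M
      alternating e-out switched f∈MY f-inc f∈M with on-cycleOf e-out
      ... | i , vert≡v = P-untouched _ (switchOn⇒P (proj₂ e-out) switched)
        (i , subst (Covers G Y) (sym vert≡v) (_ , proj₂ (Y-balanced _) (f∈M , f∈MY) , f-inc))

    unswitched : ∀ {e} (e∉M : e ∉ M) → ¬ P (cycleOf e e∉M) → e ∈ MY → e ∈ switched
    unswitched {e} e∉M ¬p e∈MY = lookup⇒[]= e switched (begin
      lookup switched e          ≡⟨ switch-lookup MY switchOn e ⟩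
      lookup MY e xor switchOn e ≡⟨ cong₂ _xor_ ([]=⇒lookup e∈MY) (¬-not (¬p ∘ switchOn⇒P e∉M)) ⟩
      true                       ∎)
      where open ≡-Reasoning

    pair-cover : ∀ {X MX} → PerfectMatching G MX → BalancedBy X MX →
      ∀ {e} (e∉M : e ∉ M) → let Z = cycleOf e e∉M in
      Untouched Z X → Untouched Z Y → (P Z → Agree Z MX MY) → (Agree Z MX MY → P Z) →
      e ∈ MX ⊎ e ∈ switched
    pair-cover {X} {MX} MX-perfect X-balanced {e} e∉M untouched-X untouched-Y P⇒agree agree⇒P =
      Data.Sum.map (lookup⇒[]= e MX) (lookup⇒[]= e switched ∘ trans (switch-lookup MY switchOn e))
        (cover-or-switched (lookup MX e) (lookup MY e) (switchOn e)
          (λ s → P⇒agree (switchOn⇒P e∉M s) zero)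
          (P⇒switchOn e∉M ∘ agree⇒P ∘
            agree-around MX-perfect X-balanced MY-perfect Y-balanced (cycleOf e e∉M)
              untouched-X untouched-Y))

  module GoodFamilyCover (A B C MA MB MC : EdgeSet G)
    (MA-perfect : PerfectMatching G MA) (MB-perfect : PerfectMatching G MB)
    (MC-perfect : PerfectMatching G MC)
    (A-balanced : BalancedBy A MA) (B-balanced : BalancedBy B MB) (C-balanced : BalancedBy C MC)
    (good : GoodFamily G M A B C) where

    PB : CycleOutside G M → Set
    PB Z = Untouched Z A × Untouched Z B × Agree Z MA MB

    PB? : ∀ Z → Dec (PB Z)
    PB? Z = ¬? (touches? Z A) ×-dec ¬? (touches? Z B) ×-dec agree? Z MA MB

    PB-same : ∀ {Z₁ Z₂} → SameCycle Z₁ Z₂ → PB Z₁ → PB Z₂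
    PB-same (_ , Z₂⊆Z₁) (untouched-A , untouched-B , agree) =
      untouched-⊆ A Z₂⊆Z₁ untouched-A , untouched-⊆ B Z₂⊆Z₁ untouched-B , agree-⊆ MA MB Z₂⊆Z₁ agree

    PC : CycleOutside G M → Set
    PC Z = Untouched Z C × ((Touches G M Z A × Untouched Z B × Agree Z MB MC) ⊎
                            (Untouched Z A × Touches G M Z B × Agree Z MA MC))

    PC? : ∀ Z → Dec (PC Z)
    PC? Z = ¬? (touches? Z C) ×-dec
              ((touches? Z A ×-dec ¬? (touches? Z B) ×-dec agree? Z MB MC) ⊎-dec
               (¬? (touches? Z A) ×-dec touches? Z B ×-dec agree? Z MA MC))

    PC-same : ∀ {Z₁ Z₂} → SameCycle Z₁ Z₂ → PC Z₁ → PC Z₂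
    PC-same (Z₁⊆Z₂ , Z₂⊆Z₁) (untouched-C , via) =
      untouched-⊆ C Z₂⊆Z₁ untouched-C , Data.Sum.map
        (λ (touched-A , untouched-B , agree) →
           touches-⊆ A Z₁⊆Z₂ touched-A , untouched-⊆ B Z₂⊆Z₁ untouched-B , agree-⊆ MB MC Z₂⊆Z₁ agree)
        (λ (untouched-A , touched-B , agree) →
           untouched-⊆ A Z₂⊆Z₁ untouched-A , touches-⊆ B Z₁⊆Z₂ touched-B , agree-⊆ MA MC Z₂⊆Z₁ agree)
        via

    module SB = SwitchOn PB PB? PB-same B MB MB-perfect B-balanced (λ _ → proj₁ ∘ proj₂)
    module SC = SwitchOn PC PC? PC-same C MC MC-perfect C-balanced (λ _ → proj₁)

    NB = SB.switched
    NC = SC.switched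

    -- On an odd cycle each of A, B, C covers one vertex, and one of these
    -- sits at a nonzero even position from e; that set's matching contains e.
    odd-cover : ∀ {e} (e∉M : e ∉ M) → Odd (len (cycleOf e e∉M)) → e ∈ MA ⊎ e ∈ NB ⊎ e ∈ NC
    odd-cover {e} e∉M odd with proj₁ good Z odd
      where Z = cycleOf e e∉M
    ... | i , j , k , cover-A , cover-B , cover-C , arcs =
      [ inj₁ ∘ first-edge-in MA-perfect A-balanced cover-A
      , [ inj₂ ∘ inj₁ ∘ SB.unswitched e∉M (λ p → proj₁ (proj₂ p) (j , proj₁ cover-B))
            ∘ first-edge-in MB-perfect B-balanced cover-B
        , inj₂ ∘ inj₂ ∘ SC.unswitched e∉M (λ p → proj₁ p (k , proj₁ cover-C))
            ∘ first-edge-in MC-perfect C-balanced cover-C ] ]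
        (oddArcs⇒evenPositive arcs)
      where
      first-edge-in : ∀ {X MX} → PerfectMatching G MX → BalancedBy X MX → ∀ {x} →
        UniqueCoverAt G M (cycleOf e e∉M) X x → EvenPositive (toℕ x) → e ∈ MX
      first-edge-in {X} {MX} MX-perfect X-balanced =
        Balanced.AlongCycle.first-edge-in X MX MX-perfect X-balanced (cycleOf e e∉M)

    -- On an even cycle at least two of A, B, C are absent; pair the
    -- matchings of two absent sets, switching the second where they agree.
    even-cover : ∀ {e} (e∉M : e ∉ M) → Even (len (cycleOf e e∉M)) → e ∈ MA ⊎ e ∈ NB ⊎ e ∈ NC
    even-cover {e} e∉M even with touches? Z A | touches? Z B | proj₂ good Z even
      where Z = cycleOf e e∉M
    ... | no untouched-A | no untouched-B | _ =
      Data.Sum.map id inj₁ (SB.pair-cover MA-perfect A-balanced e∉M untouched-A untouched-B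
        (proj₂ ∘ proj₂) (λ agree → untouched-A , untouched-B , agree))
    ... | no untouched-A | yes touched-B | absent =
      Data.Sum.map id inj₂ (SC.pair-cover MA-perfect A-balanced e∉M untouched-A untouched-C
        (λ (_ , via) → [ (λ (touched-A , _) → contradiction touched-A untouched-A)
                       , (λ (_ , _ , agree) → agree) ] via)
        (λ agree → untouched-C , inj₂ (untouched-A , touched-B , agree)))
      where
      untouched-C : Untouched (cycleOf e e∉M) C
      untouched-C = [ (λ (_ , untouched-B) → contradiction touched-B untouched-B)
                    , [ proj₂ , (λ (untouched-B , _) → contradiction touched-B untouched-B) ] ] absent
    ... | yes touched-A | no untouched-B | absent =
      [ inj₂ ∘ inj₁ ∘ SB.unswitched e∉M (λ (untouched-A , _) → untouched-A touched-A) , inj₂ ∘ inj₂ ]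
        (SC.pair-cover MB-perfect B-balanced e∉M untouched-B untouched-C
          (λ (_ , via) → [ (λ (_ , _ , agree) → agree)
                         , (λ (untouched-A , _) → contradiction touched-A untouched-A) ] via)
          (λ agree → untouched-C , inj₁ (touched-A , untouched-B , agree)))
      where
      untouched-C : Untouched (cycleOf e e∉M) C
      untouched-C = [ (λ (untouched-A , _) → contradiction touched-A untouched-A)
                    , [ (λ (untouched-A , _) → contradiction touched-A untouched-A) , proj₂ ] ] absent
    ... | yes touched-A | yes touched-B | absent =
      contradiction absent [ (λ (untouched-A , _) → untouched-A touched-A)
                           , [ (λ (untouched-A , _) → untouched-A touched-A)
                             , (λ (untouched-B , _) → untouched-B touched-B) ] ]

    matchings : Vec (EdgeSet G) 4
    matchings = M ∷ MA ∷ NB ∷ NC ∷ []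

    all-perfect : ∀ t → PerfectMatching G (lookup matchings t)
    all-perfect zero                   = M-perfect
    all-perfect (suc zero)             = MA-perfect
    all-perfect (suc (suc zero))       = SB.switched-perfect
    all-perfect (suc (suc (suc zero))) = SC.switched-perfect

    all-covered : ∀ e → Σ (Fin 4) λ t → e ∈ lookup matchings t
    all-covered e with e ∈? M
    ... | yes e∈M = zero , e∈M
    ... | no e∉M  = position ([ even-cover e∉M , odd-cover e∉M ]′ (even-or-odd (len (cycleOf e e∉M))))
      where
      position : e ∈ MA ⊎ e ∈ NB ⊎ e ∈ NC → Σ (Fin 4) λ t → e ∈ lookup matchings t
      position (inj₁ e∈MA)        = suc zero , e∈MA
      position (inj₂ (inj₁ e∈NB)) = suc (suc zero) , e∈NB
      position (inj₂ (inj₂ e∈NC)) = suc (suc (suc zero)) , e∈NC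

theorem5p1 : (G : Graph) → Cubic G → Bridgeless G →
    (M A B C : EdgeSet G) → PerfectMatching G M →
    Balanced G M A → Balanced G M B → Balanced G M C →
    Disjoint G A B → Disjoint G A C → Disjoint G B C →
    GoodFamily G M A B C →
    TauAtMost G 4
theorem5p1 G cubic _ M A B C M-perfect (MA , MA-perfect , A-balanced)
  (MB , MB-perfect , B-balanced) (MC , MC-perfect , C-balanced) _ _ _ good =
  matchings , all-perfect , all-covered
  where
  open TwoFactor G cubic M M-perfect
  open GoodFamilyCover A B C MA MB MC MA-perfect MB-perfect MC-perfect
                       A-balanced B-balanced C-balanced good
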